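{- Let $d$ be a nonnegative integer. If $n=3$ or $n=2^d$, then $h_4(n)=0$.
   Context: For a prime power $q$ and $n\in\mathbb{N}$, let $e_0,\dots,e_{n-1}$ be the standard basis of $\mathbb{F}_q^n$ (indices mod $n$) and let $\tau:\mathbb{F}_q^n\to\mathbb{F}_q^n$ be the cyclic shift $\sum_i a_ie_i\mapsto\sum_i a_ie_{i+1}$. A subspace $U\subseteq\mathbb{F}_q^n$ is cyclically covering if $\bigcup_{i=0}^{n-1}\tau^i(U)=\mathbb{F}_q^n$. $h_q(n)$ denotes the largest codimension of a cyclically covering subspace of $\mathbb{F}_q^n$; here $q=4$. -}

module Defs where

open import Data.Nat using (ℕ; zero; suc; _∸_; _≤_)
open import Data.Fin using (Fin; zero; suc; toℕ; fromℕ; inject₁)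
open import Data.Product using (Σ; ∃; _×_)
open import Relation.Binary.PropositionalEquality using (_≡_)
open import Level using (Level)

-- The field F₄ = {0, 1, ω, ω²} with ω² = ω + 1.

data F4 : Set where
  𝟎 𝟏 ω ω² : F4

infixl 6 _⊕_
infixl 7 _⊗_

_⊕_ : F4 → F4 → F4
𝟎  ⊕ y  = y
x  ⊕ 𝟎  = x
𝟏  ⊕ 𝟏  = 𝟎
𝟏  ⊕ ω  = ω²
𝟏  ⊕ ω² = ω
ω  ⊕ 𝟏  = ω²
ω  ⊕ ω  = 𝟎
ω  ⊕ ω² = 𝟏
ω² ⊕ 𝟏  = ω
ω² ⊕ ω  = 𝟏
ω² ⊕ ω² = 𝟎

_⊗_ : F4 → F4 → F4
𝟎  ⊗ y  = 𝟎
x  ⊗ 𝟎  = 𝟎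
𝟏  ⊗ y  = y
x  ⊗ 𝟏  = x
ω  ⊗ ω  = ω²
ω  ⊗ ω² = 𝟏
ω² ⊗ ω  = 𝟏
ω² ⊗ ω² = ω

Vecⁿ : ℕ → Set
Vecⁿ n = Fin n → F4

_≐_ : ∀ {n} → Vecⁿ n → Vecⁿ n → Set
u ≐ v = ∀ j → u j ≡ v j

0ᵛ : ∀ {n} → Vecⁿ n
0ᵛ _ = 𝟎

_+ᵛ_ : ∀ {n} → Vecⁿ n → Vecⁿ n → Vecⁿ n
(u +ᵛ v) j = u j ⊕ v j

_·ᵛ_ : ∀ {n} → F4 → Vecⁿ n → Vecⁿ n
(c ·ᵛ v) j = c ⊗ v j

lincomb : ∀ {n d} → (Fin d → F4) → (Fin d → Vecⁿ n) → Vecⁿ n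
lincomb {d = zero}  c b = 0ᵛ
lincomb {d = suc d} c b = (c zero ·ᵛ b zero) +ᵛ lincomb (λ i → c (suc i)) (λ i → b (suc i))

record Subspace (n : ℕ) : Set₁ where
  field
    _∋_     : Vecⁿ n → Set
    resp    : ∀ {u v} → u ≐ v → _∋_ u → _∋_ v
    zero∈   : _∋_ 0ᵛ
    +-closed : ∀ {u v} → _∋_ u → _∋_ v → _∋_ (u +ᵛ v)
    ·-closed : ∀ c {u} → _∋_ u → _∋_ (c ·ᵛ u)
open Subspace public

LinIndep : ∀ {n d} → (Fin d → Vecⁿ n) → Set
LinIndep b = ∀ c → lincomb c b ≐ 0ᵛ → ∀ i → c i ≡ 𝟎

IsBasis : ∀ {n d} → Subspace n → (Fin d → Vecⁿ n) → Set
IsBasis U b = (∀ i → (U ∋ b i))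
            × LinIndep b
            × (∀ u → (U ∋ u) → ∃ λ c → lincomb c b ≐ u)

HasDim : ∀ {n} → Subspace n → ℕ → Set
HasDim U d = ∃ λ (b : Fin d → Vecⁿ _) → IsBasis U b

HasCodim : ∀ {n} → Subspace n → ℕ → Set
HasCodim {n} U k = (k ≤ n) × HasDim U (n ∸ k)

-- Cyclic shift τ : Σ aᵢ eᵢ ↦ Σ aᵢ eᵢ₊₁, i.e. (τ a)_j = a_{j-1 mod n}.

predMod : ∀ {n} → Fin n → Fin n
predMod {suc m} zero    = fromℕ m
predMod {suc m} (suc j) = inject₁ j

τ : ∀ {n} → Vecⁿ n → Vecⁿ n
τ a j = a (predMod j)

τ^ : ∀ {n} → ℕ → Vecⁿ n → Vecⁿ n
τ^ zero    a = a
τ^ (suc k) a = τ (τ^ k a)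

CyclicallyCovering : ∀ {n} → Subspace n → Set
CyclicallyCovering {n} U =
  ∀ (v : Vecⁿ n) → ∃ λ (i : Fin n) → ∃ λ (u : Vecⁿ n) → (U ∋ u) × (τ^ (toℕ i) u ≐ v)

h₄≡ : ℕ → ℕ → Set₁
h₄≡ n m = (Σ (Subspace n) λ U → CyclicallyCovering U × HasCodim U m)
        × (∀ (U : Subspace n) k → CyclicallyCovering U → HasCodim U k → k ≤ m)

-- A proper subspace U lies in a hyperplane a^⊥ with a ≠ 0, and since τ preserves the standard
-- bilinear form, τⁱ U ⊆ (τⁱ a)^⊥.  Hence h₄(n) = 0 as soon as every a ≠ 0 admits a vector v
-- orthogonal to none of the shifts τⁱ a.  For n = 3 this is a finite check.  For n = 2^d the
-- operator Δ = 1 + τ satisfies Δⁿ = 1 + τⁿ = 0 in characteristic 2; if b = Δᵐ a is the last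
-- nonzero iterate then Δ b = 0, so b is τ-invariant, i.e. a nonzero constant c, and
-- v = (Δᵀ)ᵐ e₀ gives ⟨τⁱ a , v⟩ = ⟨τⁱ b , e₀⟩ = c for every i.

module Submission where

open import Defs
open import Data.Fin using (Fin; zero; suc; toℕ; fromℕ; inject₁; punchIn; punchOut)
import Data.Fin.Properties as Fin
open import Data.Nat using (ℕ; zero; suc; NonZero; _+_; _∸_; _^_; _≤_; z≤n; s≤s)
open import Data.Nat.GeneralisedArithmetic using (iterate)
open import Data.Nat.Properties using (≤-refl; m^n≢0; +-identityʳ; +-suc; m∸n≤m; m+[n∸m]≡n; m∸[m∸n]≡n; n∸n≡0)
open import Data.Product using (∃; _×_; _,_)
open import Data.Sum using (_⊎_; inj₁; inj₂; [_,_]′)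
open import Data.Unit using (⊤; tt)
open import Data.Vec.Functional using (head; tail; init; last; _∷_; [])
open import Function using (_∘_)
open import Relation.Binary.Definitions using (DecidableEquality)
open import Relation.Binary.PropositionalEquality using (_≡_; _≢_; refl; sym; trans; cong; cong₂; subst; module ≡-Reasoning)
open import Relation.Nullary using (¬_; Dec; yes; no; contradiction)
open import Relation.Nullary.Decidable using (map′; from-yes; ¬?; _⊎-dec_; _→-dec_; decidable-stable)
open import Relation.Unary using (Decidable)

enum : Fin 4 → F4
enum zero                   = 𝟎
enum (suc zero)             = 𝟏
enum (suc (suc zero))       = ω
enum (suc (suc (suc zero))) = ω²

index : F4 → Fin 4
index 𝟎  = zero
index 𝟏  = suc zero
index ω  = suc (suc zero)
index ω² = suc (suc (suc zero))

enum-index : ∀ x → enum (index x) ≡ x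
enum-index 𝟎  = refl
enum-index 𝟏  = refl
enum-index ω  = refl
enum-index ω² = refl

index-injective : ∀ {x y} → index x ≡ index y → x ≡ y
index-injective {x} {y} eq = trans (sym (enum-index x)) (trans (cong enum eq) (enum-index y))

infix 4 _≟_
_≟_ : DecidableEquality F4
x ≟ y = map′ index-injective (cong index) (index x Fin.≟ index y)

all? : ∀ {P : F4 → Set} → Decidable P → Dec (∀ x → P x)
all? {P} P? = map′ (λ ∀P x → subst P (enum-index x) (∀P (index x))) (λ ∀P i → ∀P (enum i))
                   (Fin.all? (P? ∘ enum))

any? : ∀ {P : F4 → Set} → Decidable P → Dec (∃ P)
any? {P} P? = map′ (λ (i , p) → enum i , p) (λ (x , p) → index x , subst P (sym (enum-index x)) p)
                   (Fin.any? (P? ∘ enum))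

⊕-comm : ∀ x y → x ⊕ y ≡ y ⊕ x
⊕-comm = from-yes (all? λ x → all? λ y → x ⊕ y ≟ y ⊕ x)

⊕-assoc : ∀ x y z → (x ⊕ y) ⊕ z ≡ x ⊕ (y ⊕ z)
⊕-assoc = from-yes (all? λ x → all? λ y → all? λ z → (x ⊕ y) ⊕ z ≟ x ⊕ (y ⊕ z))

⊕-interchange : ∀ w x y z → (w ⊕ x) ⊕ (y ⊕ z) ≡ (w ⊕ y) ⊕ (x ⊕ z)
⊕-interchange = from-yes (all? λ w → all? λ x → all? λ y → all? λ z →
                  (w ⊕ x) ⊕ (y ⊕ z) ≟ (w ⊕ y) ⊕ (x ⊕ z))

⊕-cancel-middle : ∀ x y z → (x ⊕ y) ⊕ (y ⊕ z) ≡ x ⊕ z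
⊕-cancel-middle = from-yes (all? λ x → all? λ y → all? λ z → (x ⊕ y) ⊕ (y ⊕ z) ≟ x ⊕ z)

⊕-identityʳ : ∀ x → x ⊕ 𝟎 ≡ x
⊕-identityʳ = from-yes (all? λ x → x ⊕ 𝟎 ≟ x)

⊕-self : ∀ x → x ⊕ x ≡ 𝟎
⊕-self = from-yes (all? λ x → x ⊕ x ≟ 𝟎)

⊕≡𝟎⇒≡ : ∀ x y → x ⊕ y ≡ 𝟎 → x ≡ y
⊕≡𝟎⇒≡ = from-yes (all? λ x → all? λ y → x ⊕ y ≟ 𝟎 →-dec x ≟ y)

⊗-comm : ∀ x y → x ⊗ y ≡ y ⊗ x
⊗-comm = from-yes (all? λ x → all? λ y → x ⊗ y ≟ y ⊗ x)

⊗-assoc : ∀ x y z → (x ⊗ y) ⊗ z ≡ x ⊗ (y ⊗ z)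
⊗-assoc = from-yes (all? λ x → all? λ y → all? λ z → (x ⊗ y) ⊗ z ≟ x ⊗ (y ⊗ z))

⊗-identityˡ : ∀ x → 𝟏 ⊗ x ≡ x
⊗-identityˡ = from-yes (all? λ x → 𝟏 ⊗ x ≟ x)

⊗-identityʳ : ∀ x → x ⊗ 𝟏 ≡ x
⊗-identityʳ = from-yes (all? λ x → x ⊗ 𝟏 ≟ x)

⊗-zeroʳ : ∀ x → x ⊗ 𝟎 ≡ 𝟎
⊗-zeroʳ = from-yes (all? λ x → x ⊗ 𝟎 ≟ 𝟎)

⊗-distribˡ-⊕ : ∀ x y z → x ⊗ (y ⊕ z) ≡ x ⊗ y ⊕ x ⊗ z
⊗-distribˡ-⊕ = from-yes (all? λ x → all? λ y → all? λ z → x ⊗ (y ⊕ z) ≟ x ⊗ y ⊕ x ⊗ z)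

⊗-distribʳ-⊕ : ∀ x y z → (y ⊕ z) ⊗ x ≡ y ⊗ x ⊕ z ⊗ x
⊗-distribʳ-⊕ = from-yes (all? λ x → all? λ y → all? λ z → (y ⊕ z) ⊗ x ≟ y ⊗ x ⊕ z ⊗ x)

_⁻¹ : F4 → F4
𝟎 ⁻¹  = 𝟎
𝟏 ⁻¹  = 𝟏
ω ⁻¹  = ω²
ω² ⁻¹ = ω

⊗-inverseʳ : ∀ x → x ≢ 𝟎 → x ⊗ x ⁻¹ ≡ 𝟏
⊗-inverseʳ = from-yes (all? λ x → ¬? (x ≟ 𝟎) →-dec x ⊗ x ⁻¹ ≟ 𝟏)

≐0ᵛ? : ∀ {n} (u : Vecⁿ n) → Dec (u ≐ 0ᵛ)
≐0ᵛ? u = Fin.all? λ j → u j ≟ 𝟎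

⟨_,_⟩ : ∀ {n} → Vecⁿ n → Vecⁿ n → F4
⟨_,_⟩ {zero}  u v = 𝟎
⟨_,_⟩ {suc n} u v = head u ⊗ head v ⊕ ⟨ tail u , tail v ⟩

⟨⟩-cong : ∀ {n} {u u′ v v′ : Vecⁿ n} → u ≐ u′ → v ≐ v′ → ⟨ u , v ⟩ ≡ ⟨ u′ , v′ ⟩
⟨⟩-cong {zero}  _   _   = refl
⟨⟩-cong {suc n} u≐u′ v≐v′ =
  cong₂ _⊕_ (cong₂ _⊗_ (u≐u′ zero) (v≐v′ zero)) (⟨⟩-cong (u≐u′ ∘ suc) (v≐v′ ∘ suc))

⟨⟩-congˡ : ∀ {n} {u u′ : Vecⁿ n} (v : Vecⁿ n) → u ≐ u′ → ⟨ u , v ⟩ ≡ ⟨ u′ , v ⟩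
⟨⟩-congˡ v u≐u′ = ⟨⟩-cong u≐u′ λ _ → refl

⟨⟩-congʳ : ∀ {n} (u : Vecⁿ n) {v v′ : Vecⁿ n} → v ≐ v′ → ⟨ u , v ⟩ ≡ ⟨ u , v′ ⟩
⟨⟩-congʳ u = ⟨⟩-cong λ _ → refl

⟨⟩-comm : ∀ {n} (u v : Vecⁿ n) → ⟨ u , v ⟩ ≡ ⟨ v , u ⟩
⟨⟩-comm {zero}  u v = refl
⟨⟩-comm {suc n} u v = cong₂ _⊕_ (⊗-comm (head u) (head v)) (⟨⟩-comm (tail u) (tail v))

⟨⟩-zeroˡ : ∀ {n} (v : Vecⁿ n) → ⟨ 0ᵛ , v ⟩ ≡ 𝟎
⟨⟩-zeroˡ {zero}  v = refl
⟨⟩-zeroˡ {suc n} v = ⟨⟩-zeroˡ (tail v)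

⟨⟩-+ˡ : ∀ {n} (u v w : Vecⁿ n) → ⟨ u +ᵛ v , w ⟩ ≡ ⟨ u , w ⟩ ⊕ ⟨ v , w ⟩
⟨⟩-+ˡ {zero}  u v w = refl
⟨⟩-+ˡ {suc n} u v w = begin
  (head u ⊕ head v) ⊗ head w ⊕ ⟨ tail u +ᵛ tail v , tail w ⟩
    ≡⟨ cong₂ _⊕_ (⊗-distribʳ-⊕ (head w) (head u) (head v)) (⟨⟩-+ˡ (tail u) (tail v) (tail w)) ⟩
  (head u ⊗ head w ⊕ head v ⊗ head w) ⊕ (⟨ tail u , tail w ⟩ ⊕ ⟨ tail v , tail w ⟩)
    ≡⟨ ⊕-interchange (head u ⊗ head w) _ _ _ ⟩
  ⟨ u , w ⟩ ⊕ ⟨ v , w ⟩ ∎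
  where open ≡-Reasoning

⟨⟩-+ʳ : ∀ {n} (u v w : Vecⁿ n) → ⟨ u , v +ᵛ w ⟩ ≡ ⟨ u , v ⟩ ⊕ ⟨ u , w ⟩
⟨⟩-+ʳ u v w = begin
  ⟨ u , v +ᵛ w ⟩          ≡⟨ ⟨⟩-comm u (v +ᵛ w) ⟩
  ⟨ v +ᵛ w , u ⟩          ≡⟨ ⟨⟩-+ˡ v w u ⟩
  ⟨ v , u ⟩ ⊕ ⟨ w , u ⟩   ≡⟨ cong₂ _⊕_ (⟨⟩-comm v u) (⟨⟩-comm w u) ⟩
  ⟨ u , v ⟩ ⊕ ⟨ u , w ⟩   ∎
  where open ≡-Reasoning

⟨⟩-·ˡ : ∀ {n} c (u v : Vecⁿ n) → ⟨ c ·ᵛ u , v ⟩ ≡ c ⊗ ⟨ u , v ⟩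
⟨⟩-·ˡ {zero}  c u v = sym (⊗-zeroʳ c)
⟨⟩-·ˡ {suc n} c u v = begin
  (c ⊗ head u) ⊗ head v ⊕ ⟨ c ·ᵛ tail u , tail v ⟩
    ≡⟨ cong₂ _⊕_ (⊗-assoc c (head u) (head v)) (⟨⟩-·ˡ c (tail u) (tail v)) ⟩
  c ⊗ (head u ⊗ head v) ⊕ c ⊗ ⟨ tail u , tail v ⟩
    ≡⟨ sym (⊗-distribˡ-⊕ c _ _) ⟩
  c ⊗ ⟨ u , v ⟩ ∎
  where open ≡-Reasoning

⟨lincomb,⟩≡𝟎 : ∀ {n d} (c : Fin d → F4) (b : Fin d → Vecⁿ n) (a : Vecⁿ n) →
               (∀ i → ⟨ b i , a ⟩ ≡ 𝟎) → ⟨ lincomb c b , a ⟩ ≡ 𝟎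
⟨lincomb,⟩≡𝟎 {d = zero}  c b a _  = ⟨⟩-zeroˡ a
⟨lincomb,⟩≡𝟎 {d = suc d} c b a b⊥a = begin
  ⟨ (c zero ·ᵛ b zero) +ᵛ lincomb (tail c) (tail b) , a ⟩
    ≡⟨ ⟨⟩-+ˡ _ _ a ⟩
  ⟨ c zero ·ᵛ b zero , a ⟩ ⊕ ⟨ lincomb (tail c) (tail b) , a ⟩
    ≡⟨ cong₂ _⊕_ (⟨⟩-·ˡ (c zero) (b zero) a) (⟨lincomb,⟩≡𝟎 (tail c) (tail b) a (b⊥a ∘ suc)) ⟩
  c zero ⊗ ⟨ b zero , a ⟩ ⊕ 𝟎
    ≡⟨ cong (λ x → c zero ⊗ x ⊕ 𝟎) (b⊥a zero) ⟩
  c zero ⊗ 𝟎 ⊕ 𝟎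
    ≡⟨ ⊕-identityʳ _ ⟩
  c zero ⊗ 𝟎
    ≡⟨ ⊗-zeroʳ (c zero) ⟩
  𝟎 ∎
  where open ≡-Reasoning

unit : ∀ {n} → Fin n → Vecⁿ n
unit zero    = 𝟏 ∷ 0ᵛ
unit (suc i) = 𝟎 ∷ unit i

⟨,unit-zero⟩ : ∀ {n} (u : Vecⁿ (suc n)) → ⟨ u , unit zero ⟩ ≡ head u
⟨,unit-zero⟩ u = begin
  head u ⊗ 𝟏 ⊕ ⟨ tail u , 0ᵛ ⟩   ≡⟨ cong (head u ⊗ 𝟏 ⊕_) (trans (⟨⟩-comm (tail u) 0ᵛ) (⟨⟩-zeroˡ (tail u))) ⟩
  head u ⊗ 𝟏 ⊕ 𝟎                 ≡⟨ ⊕-identityʳ (head u ⊗ 𝟏) ⟩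
  head u ⊗ 𝟏                     ≡⟨ ⊗-identityʳ (head u) ⟩
  head u                         ∎
  where open ≡-Reasoning

unit-zero≢0ᵛ : ∀ {n} → ¬ unit {suc n} zero ≐ 0ᵛ
unit-zero≢0ᵛ e₀≐0 with e₀≐0 zero
... | ()

lincomb-𝟎∷ : ∀ {n d} (c : Fin d → F4) (b : Fin d → Vecⁿ n) →
             lincomb c (λ i → 𝟎 ∷ b i) ≐ (𝟎 ∷ lincomb c b)
lincomb-𝟎∷ {d = zero}  c b zero    = refl
lincomb-𝟎∷ {d = zero}  c b (suc j) = refl
lincomb-𝟎∷ {d = suc d} c b zero    =
  trans (cong (c zero ⊗ 𝟎 ⊕_) (lincomb-𝟎∷ (tail c) (tail b) zero)) (trans (⊕-identityʳ _) (⊗-zeroʳ (c zero)))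
lincomb-𝟎∷ {d = suc d} c b (suc j) = cong (c zero ⊗ b zero j ⊕_) (lincomb-𝟎∷ (tail c) (tail b) (suc j))

lincomb-unit : ∀ {n} (c : Vecⁿ n) → lincomb c unit ≐ c
lincomb-unit {suc n} c zero    =
  trans (cong₂ _⊕_ (⊗-identityʳ (c zero)) (lincomb-𝟎∷ (tail c) unit zero)) (⊕-identityʳ (c zero))
lincomb-unit {suc n} c (suc j) =
  cong₂ _⊕_ (⊗-zeroʳ (c zero)) (trans (lincomb-𝟎∷ (tail c) unit (suc j)) (lincomb-unit (tail c) j))

iterate-+ : ∀ {A : Set} (f : A → A) x m n → iterate f x (m + n) ≡ iterate f (iterate f x m) n
iterate-+ f x zero    n = refl
iterate-+ f x (suc m) n = iterate-+ f (f x) m n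

iterate-comm : ∀ {A : Set} (f : A → A) x k → iterate f (f x) k ≡ f (iterate f x k)
iterate-comm f x zero    = refl
iterate-comm f x (suc k) = iterate-comm f (f x) k

τ-cong : ∀ {n} {u v : Vecⁿ n} → u ≐ v → τ u ≐ τ v
τ-cong u≐v = u≐v ∘ predMod

τ^-cong : ∀ {n} k {u v : Vecⁿ n} → u ≐ v → τ^ k u ≐ τ^ k v
τ^-cong zero    u≐v = u≐v
τ^-cong (suc k) u≐v = τ-cong (τ^-cong k u≐v)

τ^-pointwise : ∀ {n} k (a : Vecⁿ n) j → τ^ k a j ≡ a (iterate predMod j k)
τ^-pointwise zero    a j = refl
τ^-pointwise (suc k) a j = τ^-pointwise k a (predMod j)

toℕ-predMod^ : ∀ {n} k (j : Fin n) → k ≤ toℕ j → toℕ (iterate predMod j k) ≡ toℕ j ∸ k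
toℕ-predMod^ zero    j       _         = refl
toℕ-predMod^ (suc k) (suc j) (s≤s k≤j) = begin
  toℕ (iterate predMod (inject₁ j) k)
    ≡⟨ toℕ-predMod^ k (inject₁ j) (subst (k ≤_) (sym (Fin.toℕ-inject₁ j)) k≤j) ⟩
  toℕ (inject₁ j) ∸ k
    ≡⟨ cong (_∸ k) (Fin.toℕ-inject₁ j) ⟩
  toℕ j ∸ k ∎
  where open ≡-Reasoning

predMod^toℕ : ∀ {n} (j : Fin (suc n)) → iterate predMod j (toℕ j) ≡ zero
predMod^toℕ j = Fin.toℕ-injective (trans (toℕ-predMod^ (toℕ j) j ≤-refl) (n∸n≡0 (toℕ j)))

predMod^-period : ∀ {n} (j : Fin n) → iterate predMod j n ≡ j
predMod^-period {suc m} j = Fin.toℕ-injective (begin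
  toℕ (iterate predMod j (suc m))
    ≡⟨ cong (toℕ ∘ iterate predMod j) (sym t+[1+r]≡1+m) ⟩
  toℕ (iterate predMod j (t + suc r))
    ≡⟨ cong toℕ (iterate-+ predMod j t (suc r)) ⟩
  toℕ (iterate predMod (iterate predMod j t) (suc r))
    ≡⟨ cong (λ i → toℕ (iterate predMod i (suc r))) (predMod^toℕ j) ⟩
  toℕ (iterate predMod (fromℕ m) r)
    ≡⟨ toℕ-predMod^ r (fromℕ m) r≤m ⟩
  toℕ (fromℕ m) ∸ r
    ≡⟨ cong (_∸ r) (Fin.toℕ-fromℕ m) ⟩
  m ∸ (m ∸ t)
    ≡⟨ m∸[m∸n]≡n t≤m ⟩
  t ∎)
  where
  open ≡-Reasoning
  t = toℕ j
  r = m ∸ t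
  t≤m : t ≤ m
  t≤m = Fin.toℕ≤pred[n] j
  t+[1+r]≡1+m : t + suc r ≡ suc m
  t+[1+r]≡1+m = trans (+-suc t r) (cong suc (m+[n∸m]≡n t≤m))
  r≤m : r ≤ toℕ (fromℕ m)
  r≤m = subst (r ≤_) (sym (Fin.toℕ-fromℕ m)) (m∸n≤m m t)

τ^-period : ∀ {n} (a : Vecⁿ n) → τ^ n a ≐ a
τ^-period {n} a j = trans (τ^-pointwise n a j) (cong a (predMod^-period j))

τ-invariant⇒τ^-invariant : ∀ {n} {b : Vecⁿ n} → τ b ≐ b → ∀ k → τ^ k b ≐ b
τ-invariant⇒τ^-invariant τb≐b zero    _ = refl
τ-invariant⇒τ^-invariant τb≐b (suc k) j = trans (τ-cong (τ-invariant⇒τ^-invariant τb≐b k) j) (τb≐b j)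

τ-invariant⇒constant : ∀ {n} {b : Vecⁿ (suc n)} → τ b ≐ b → ∀ j → b j ≡ b zero
τ-invariant⇒constant {b = b} τb≐b j = begin
  b j                            ≡⟨ sym (τ-invariant⇒τ^-invariant τb≐b (toℕ j) j) ⟩
  τ^ (toℕ j) b j                 ≡⟨ τ^-pointwise (toℕ j) b j ⟩
  b (iterate predMod j (toℕ j))  ≡⟨ cong b (predMod^toℕ j) ⟩
  b zero                         ∎
  where open ≡-Reasoning

⟨⟩-init-last : ∀ {n} (u v : Vecⁿ (suc n)) → ⟨ u , v ⟩ ≡ ⟨ init u , init v ⟩ ⊕ last u ⊗ last v
⟨⟩-init-last {zero}  u v = ⊕-identityʳ _
⟨⟩-init-last {suc n} u v = trans (cong (head u ⊗ head v ⊕_) (⟨⟩-init-last (tail u) (tail v)))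
                                 (sym (⊕-assoc (head u ⊗ head v) _ _))

⟨τ,τ⟩ : ∀ {n} (u v : Vecⁿ n) → ⟨ τ u , τ v ⟩ ≡ ⟨ u , v ⟩
⟨τ,τ⟩ {zero}  u v = refl
⟨τ,τ⟩ {suc n} u v = trans (⊕-comm (last u ⊗ last v) _) (sym (⟨⟩-init-last u v))

⟨τ^,τ^⟩ : ∀ {n} k (u v : Vecⁿ n) → ⟨ τ^ k u , τ^ k v ⟩ ≡ ⟨ u , v ⟩
⟨τ^,τ^⟩ zero    u v = refl
⟨τ^,τ^⟩ (suc k) u v = trans (⟨τ,τ⟩ (τ^ k u) (τ^ k v)) (⟨τ^,τ^⟩ k u v)

⟨τ,⟩ : ∀ {n} (u v : Vecⁿ n) → ⟨ τ u , v ⟩ ≡ ⟨ u , τ^ (n ∸ 1) v ⟩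
⟨τ,⟩ {zero}  u v = refl
⟨τ,⟩ {suc n} u v = trans (⟨⟩-congʳ (τ u) (sym ∘ τ^-period v)) (⟨τ,τ⟩ u (τ^ n v))

-- The operator Δ = 1 + τ

Δ : ∀ {n} → Vecⁿ n → Vecⁿ n
Δ x = x +ᵛ τ x

Δ-cong : ∀ {n} {u v : Vecⁿ n} → u ≐ v → Δ u ≐ Δ v
Δ-cong u≐v j = cong₂ _⊕_ (u≐v j) (u≐v (predMod j))

Δ^-cong : ∀ {n} m {u v : Vecⁿ n} → u ≐ v → iterate Δ u m ≐ iterate Δ v m
Δ^-cong zero    u≐v = u≐v
Δ^-cong (suc m) u≐v = Δ^-cong m (Δ-cong u≐v)

τ^-Δ : ∀ {n} k (y : Vecⁿ n) → τ^ k (Δ y) ≐ Δ (τ^ k y)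
τ^-Δ zero    y = λ _ → refl
τ^-Δ (suc k) y = τ-cong (τ^-Δ k y)

Δ^-τ^ : ∀ {n} m k (y : Vecⁿ n) → iterate Δ (τ^ k y) m ≐ τ^ k (iterate Δ y m)
Δ^-τ^ zero    k y = λ _ → refl
Δ^-τ^ (suc m) k y j = trans (Δ^-cong m (sym ∘ τ^-Δ k y) j) (Δ^-τ^ m k (Δ y) j)

Δ^2^ : ∀ {n} d (x : Vecⁿ n) j → iterate Δ x (2 ^ d) j ≡ x j ⊕ x (iterate predMod j (2 ^ d))
Δ^2^ zero    x j = refl
Δ^2^ (suc d) x j = begin
  iterate Δ x (2 ^ suc d) j                  ≡⟨ cong (λ m → iterate Δ x m j) 2^[1+d]≡K+K ⟩
  iterate Δ x (K + K) j                      ≡⟨ cong (λ y → y j) (iterate-+ Δ x K K) ⟩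
  iterate Δ y K j                            ≡⟨ Δ^2^ d y j ⟩
  y j ⊕ y (π^K j)                            ≡⟨ cong₂ _⊕_ (Δ^2^ d x j) (Δ^2^ d x (π^K j)) ⟩
  (x j ⊕ x (π^K j)) ⊕ (x (π^K j) ⊕ x (π^K (π^K j)))
                                             ≡⟨ ⊕-cancel-middle (x j) (x (π^K j)) (x (π^K (π^K j))) ⟩
  x j ⊕ x (π^K (π^K j))                      ≡⟨ cong (λ i → x j ⊕ x i) (sym (iterate-+ predMod j K K)) ⟩
  x j ⊕ x (iterate predMod j (K + K))        ≡⟨ cong (λ m → x j ⊕ x (iterate predMod j m)) (sym 2^[1+d]≡K+K) ⟩
  x j ⊕ x (iterate predMod j (2 ^ suc d))    ∎
  where
  open ≡-Reasoning
  K = 2 ^ d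
  y = iterate Δ x K
  π^K : _ → _
  π^K i = iterate predMod i K
  2^[1+d]≡K+K : 2 ^ suc d ≡ K + K
  2^[1+d]≡K+K = cong (K +_) (+-identityʳ K)

Δ-nilpotent : ∀ d (x : Vecⁿ (2 ^ d)) → iterate Δ x (2 ^ d) ≐ 0ᵛ
Δ-nilpotent d x j = begin
  iterate Δ x (2 ^ d) j                   ≡⟨ Δ^2^ d x j ⟩
  x j ⊕ x (iterate predMod j (2 ^ d))     ≡⟨ cong (λ i → x j ⊕ x i) (predMod^-period j) ⟩
  x j ⊕ x j                               ≡⟨ ⊕-self (x j) ⟩
  𝟎                                       ∎
  where open ≡-Reasoning

Δᵀ : ∀ {n} → Vecⁿ n → Vecⁿ n
Δᵀ {n} y = y +ᵛ τ^ (n ∸ 1) y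

⟨Δ,⟩ : ∀ {n} (x y : Vecⁿ n) → ⟨ Δ x , y ⟩ ≡ ⟨ x , Δᵀ y ⟩
⟨Δ,⟩ {n} x y = begin
  ⟨ x +ᵛ τ x , y ⟩                   ≡⟨ ⟨⟩-+ˡ x (τ x) y ⟩
  ⟨ x , y ⟩ ⊕ ⟨ τ x , y ⟩            ≡⟨ cong (⟨ x , y ⟩ ⊕_) (⟨τ,⟩ x y) ⟩
  ⟨ x , y ⟩ ⊕ ⟨ x , τ^ (n ∸ 1) y ⟩   ≡⟨ sym (⟨⟩-+ʳ x y _) ⟩
  ⟨ x , Δᵀ y ⟩                       ∎
  where open ≡-Reasoning

⟨⟩-adjoint-iterate : ∀ {n} {f g : Vecⁿ n → Vecⁿ n} → (∀ x y → ⟨ f x , y ⟩ ≡ ⟨ x , g y ⟩) →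
                     ∀ m x y → ⟨ iterate f x m , y ⟩ ≡ ⟨ x , iterate g y m ⟩
⟨⟩-adjoint-iterate adj zero    x y = refl
⟨⟩-adjoint-iterate {f = f} {g} adj (suc m) x y = begin
  ⟨ iterate f (f x) m , y ⟩   ≡⟨ ⟨⟩-adjoint-iterate adj m (f x) y ⟩
  ⟨ f x , iterate g y m ⟩     ≡⟨ adj x _ ⟩
  ⟨ x , g (iterate g y m) ⟩   ≡⟨ cong ⟨ x ,_⟩ (sym (iterate-comm g y m)) ⟩
  ⟨ x , iterate g (g y) m ⟩   ∎
  where open ≡-Reasoning

-- Hyperplanes whose shifts do not cover F₄ⁿ

-- v lies on none of the hyperplanes (τⁱ a)^⊥ = τⁱ(a^⊥)
Avoids : ∀ {n} → Vecⁿ n → Vecⁿ n → Set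
Avoids {n} a v = ∀ (i : Fin n) → ⟨ τ^ (toℕ i) a , v ⟩ ≢ 𝟎

avoids? : ∀ {n} (a v : Vecⁿ n) → Dec (Avoids a v)
avoids? a v = Fin.all? λ i → ¬? (⟨ τ^ (toℕ i) a , v ⟩ ≟ 𝟎)

Avoids-congˡ : ∀ {n} {a a′ v : Vecⁿ n} → a ≐ a′ → Avoids a′ v → Avoids a v
Avoids-congˡ {v = v} a≐a′ avoids i = avoids i ∘ trans (sym (⟨⟩-congˡ v (τ^-cong (toℕ i) a≐a′)))

NoCoveringHyperplane : ℕ → Set
NoCoveringHyperplane n = ∀ (a : Vecⁿ n) → ¬ a ≐ 0ᵛ → ∃ (Avoids a)

transition : ∀ {Z : ℕ → Set} → Decidable Z → ¬ Z 0 → ∀ N → Z N → ∃ λ m → ¬ Z m × Z (suc m)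
transition Z? ¬Z₀ zero    Z₀ = contradiction Z₀ ¬Z₀
transition Z? ¬Z₀ (suc N) Z₁₊ₙ with Z? N
... | yes Zₙ = transition Z? ¬Z₀ N Zₙ
... | no ¬Zₙ = N , ¬Zₙ , Z₁₊ₙ

nilpotent-Δ⇒no-covering-hyperplane : ∀ {n} N → (∀ (x : Vecⁿ n) → iterate Δ x N ≐ 0ᵛ) →
                                     NoCoveringHyperplane n
nilpotent-Δ⇒no-covering-hyperplane {zero}  N nil a a≢0 = contradiction (λ ()) a≢0
nilpotent-Δ⇒no-covering-hyperplane {suc n} N nil a a≢0
  with transition (λ m → ≐0ᵛ? (iterate Δ a m)) a≢0 N (nil a)
... | m , b≢0 , Δb≐0 = v , λ i → b₀≢𝟎 ∘ trans (sym (⟨τ^a,v⟩≡b₀ (toℕ i)))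
  where
  open ≡-Reasoning
  b = iterate Δ a m
  v = iterate Δᵀ (unit zero) m
  τb≐b : τ b ≐ b
  τb≐b j = sym (⊕≡𝟎⇒≡ (b j) (τ b j) (trans (cong (λ y → y j) (sym (iterate-comm Δ a m))) (Δb≐0 j)))
  b₀≢𝟎 : b zero ≢ 𝟎
  b₀≢𝟎 b₀≡𝟎 = b≢0 (λ j → trans (τ-invariant⇒constant τb≐b j) b₀≡𝟎)
  ⟨τ^a,v⟩≡b₀ : ∀ k → ⟨ τ^ k a , v ⟩ ≡ b zero
  ⟨τ^a,v⟩≡b₀ k = begin
    ⟨ τ^ k a , v ⟩                       ≡⟨ sym (⟨⟩-adjoint-iterate ⟨Δ,⟩ m (τ^ k a) (unit zero)) ⟩
    ⟨ iterate Δ (τ^ k a) m , unit zero ⟩ ≡⟨ ⟨⟩-congˡ (unit zero) (Δ^-τ^ m k a) ⟩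
    ⟨ τ^ k b , unit zero ⟩               ≡⟨ ⟨⟩-congˡ (unit zero) (τ-invariant⇒τ^-invariant τb≐b k) ⟩
    ⟨ b , unit zero ⟩                    ≡⟨ ⟨,unit-zero⟩ b ⟩
    b zero                               ∎

avoiding-vector-3 : ∀ x y z → (x ∷ y ∷ z ∷ []) ≐ 0ᵛ ⊎
                    ∃ λ v₀ → ∃ λ v₁ → ∃ λ v₂ → Avoids (x ∷ y ∷ z ∷ []) (v₀ ∷ v₁ ∷ v₂ ∷ [])
avoiding-vector-3 = from-yes (all? λ x → all? λ y → all? λ z → ≐0ᵛ? (x ∷ y ∷ z ∷ []) ⊎-dec
  any? λ v₀ → any? λ v₁ → any? λ v₂ → avoids? (x ∷ y ∷ z ∷ []) (v₀ ∷ v₁ ∷ v₂ ∷ []))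

no-covering-hyperplane-3 : NoCoveringHyperplane 3
no-covering-hyperplane-3 a a≢0 =
  [ (λ a′≐0 → contradiction (λ j → trans (a≐a′ j) (a′≐0 j)) a≢0)
  , (λ (v₀ , v₁ , v₂ , avoids) → let v = v₀ ∷ v₁ ∷ v₂ ∷ [] in v , Avoids-congˡ {v = v} a≐a′ avoids)
  ]′ (avoiding-vector-3 (a zero) (a (suc zero)) (a (suc (suc zero))))
  where
  a≐a′ : a ≐ (a zero ∷ a (suc zero) ∷ a (suc (suc zero)) ∷ [])
  a≐a′ zero             = refl
  a≐a′ (suc zero)       = refl
  a≐a′ (suc (suc zero)) = refl

-- Orthogonal complements and the reduction to hyperplanes

-- One step of Gaussian elimination on the first coordinate, with pivot p.
eliminate : ∀ {n} → Vecⁿ (suc n) → Vecⁿ (suc n) → Vecⁿ n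
eliminate p e = tail e +ᵛ ((head e ⊗ head p ⁻¹) ·ᵛ tail p)

extend : ∀ {n} → Vecⁿ (suc n) → Vecⁿ n → Vecⁿ (suc n)
extend p a = (head p ⁻¹ ⊗ ⟨ tail p , a ⟩) ∷ a

⟨,extend⟩ : ∀ {n} (p e : Vecⁿ (suc n)) (a : Vecⁿ n) → ⟨ e , extend p a ⟩ ≡ ⟨ eliminate p e , a ⟩
⟨,extend⟩ p e a = begin
  head e ⊗ (head p ⁻¹ ⊗ ⟨ tail p , a ⟩) ⊕ ⟨ tail e , a ⟩
    ≡⟨ ⊕-comm (head e ⊗ (head p ⁻¹ ⊗ ⟨ tail p , a ⟩)) _ ⟩
  ⟨ tail e , a ⟩ ⊕ head e ⊗ (head p ⁻¹ ⊗ ⟨ tail p , a ⟩)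
    ≡⟨ cong (⟨ tail e , a ⟩ ⊕_) (sym (⊗-assoc (head e) (head p ⁻¹) _)) ⟩
  ⟨ tail e , a ⟩ ⊕ (head e ⊗ head p ⁻¹) ⊗ ⟨ tail p , a ⟩
    ≡⟨ cong (⟨ tail e , a ⟩ ⊕_) (sym (⟨⟩-·ˡ (head e ⊗ head p ⁻¹) (tail p) a)) ⟩
  ⟨ tail e , a ⟩ ⊕ ⟨ (head e ⊗ head p ⁻¹) ·ᵛ tail p , a ⟩
    ≡⟨ sym (⟨⟩-+ˡ (tail e) _ a) ⟩
  ⟨ eliminate p e , a ⟩ ∎
  where open ≡-Reasoning

eliminate-self : ∀ {n} (p : Vecⁿ (suc n)) → head p ≢ 𝟎 → eliminate p p ≐ 0ᵛ
eliminate-self p p₀≢𝟎 j = begin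
  tail p j ⊕ (head p ⊗ head p ⁻¹) ⊗ tail p j
    ≡⟨ cong (λ x → tail p j ⊕ x ⊗ tail p j) (⊗-inverseʳ (head p) p₀≢𝟎) ⟩
  tail p j ⊕ 𝟏 ⊗ tail p j
    ≡⟨ cong (tail p j ⊕_) (⊗-identityˡ (tail p j)) ⟩
  tail p j ⊕ tail p j
    ≡⟨ ⊕-self (tail p j) ⟩
  𝟎 ∎
  where open ≡-Reasoning

∃-nonzero-orthogonal : ∀ {n k} → k ≤ n → (b : Fin k → Vecⁿ (suc n)) →
                       ∃ λ a → ¬ a ≐ 0ᵛ × ∀ i → ⟨ b i , a ⟩ ≡ 𝟎
∃-nonzero-orthogonal {k = zero} _ b = unit zero , unit-zero≢0ᵛ , λ ()
∃-nonzero-orthogonal {suc n} {suc k} (s≤s k≤n) b with Fin.any? (λ i → ¬? (head (b i) ≟ 𝟎))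
... | no ∄pivot = unit zero , unit-zero≢0ᵛ , λ i →
  trans (⟨,unit-zero⟩ (b i)) (decidable-stable (head (b i) ≟ 𝟎) (λ bᵢ₀≢𝟎 → ∄pivot (i , bᵢ₀≢𝟎)))
... | yes (i , p₀≢𝟎) with ∃-nonzero-orthogonal k≤n (λ j → eliminate (b i) (b (punchIn i j)))
...   | a , a≢0 , a⊥ = extend (b i) a , (λ ext≐0 → a≢0 (ext≐0 ∘ suc)) , ⟨b,extend⟩≡𝟎
  where
  ⟨b,extend⟩≡𝟎 : ∀ j → ⟨ b j , extend (b i) a ⟩ ≡ 𝟎
  ⟨b,extend⟩≡𝟎 j with i Fin.≟ j
  ... | yes refl = trans (⟨,extend⟩ (b i) (b i) a)
                         (trans (⟨⟩-congˡ a (eliminate-self (b i) p₀≢𝟎)) (⟨⟩-zeroˡ a))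
  ... | no i≢j   = trans (⟨,extend⟩ (b i) (b j) a)
                         (subst (λ j → ⟨ eliminate (b i) (b j) , a ⟩ ≡ 𝟎)
                                (Fin.punchIn-punchOut i≢j) (a⊥ (punchOut i≢j)))

_⟂_ : ∀ {n} → Vecⁿ n → Subspace n → Set
a ⟂ U = ∀ u → U ∋ u → ⟨ u , a ⟩ ≡ 𝟎

positive-codim⇒nonzero-orthogonal : ∀ {n k} {U : Subspace n} → HasCodim U (suc k) →
                                    ∃ λ a → ¬ a ≐ 0ᵛ × a ⟂ U
positive-codim⇒nonzero-orthogonal {suc n} {k} (s≤s k≤n , b , _ , _ , spans)
  with ∃-nonzero-orthogonal (m∸n≤m n k) b
... | a , a≢0 , b⊥a = a , a≢0 , λ u u∈U → u⊥a (spans u u∈U)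
  where
  u⊥a : ∀ {u} → ∃ (λ c → lincomb c b ≐ u) → ⟨ u , a ⟩ ≡ 𝟎
  u⊥a (c , lincomb≐u) = trans (sym (⟨⟩-congˡ a lincomb≐u)) (⟨lincomb,⟩≡𝟎 c b a b⊥a)

covering⇒no-nonzero-orthogonal : ∀ {n} {U : Subspace n} → NoCoveringHyperplane n → CyclicallyCovering U →
                                 ∀ a → ¬ a ≐ 0ᵛ → ¬ a ⟂ U
covering⇒no-nonzero-orthogonal noCover cover a a≢0 a⟂U with noCover a a≢0
... | v , avoids with cover v
... | i , u , u∈U , τⁱu≐v = avoids i (begin
  ⟨ τ^ (toℕ i) a , v ⟩               ≡⟨ ⟨⟩-congʳ (τ^ (toℕ i) a) (sym ∘ τⁱu≐v) ⟩
  ⟨ τ^ (toℕ i) a , τ^ (toℕ i) u ⟩    ≡⟨ ⟨τ^,τ^⟩ (toℕ i) a u ⟩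
  ⟨ a , u ⟩                          ≡⟨ ⟨⟩-comm a u ⟩
  ⟨ u , a ⟩                          ≡⟨ a⟂U u u∈U ⟩
  𝟎                                  ∎)
  where open ≡-Reasoning

full : ∀ n → Subspace n
full n = record
  { _∋_      = λ _ → ⊤
  ; resp     = λ _ _ → tt
  ; zero∈    = tt
  ; +-closed = λ _ _ → tt
  ; ·-closed = λ _ _ → tt
  }

full-covering : ∀ {n} → CyclicallyCovering (full (suc n))
full-covering v = zero , v , tt , λ _ → refl

unit-basis : ∀ {n} → IsBasis (full n) unit
unit-basis = (λ _ → tt) , (λ c c≐0 i → trans (sym (lincomb-unit c i)) (c≐0 i)) , λ u _ → u , lincomb-unit u

no-covering-hyperplane⇒h₄≡0 : ∀ {n} .{{_ : NonZero n}} → NoCoveringHyperplane n → h₄≡ n 0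
no-covering-hyperplane⇒h₄≡0 {suc n} noCover = (full (suc n) , full-covering , z≤n , unit , unit-basis) , codim≤0
  where
  codim≤0 : ∀ U k → CyclicallyCovering U → HasCodim U k → k ≤ 0
  codim≤0 U zero    _     _     = z≤n
  codim≤0 U (suc k) cover codim with positive-codim⇒nonzero-orthogonal {U = U} codim
  ... | a , a≢0 , a⟂U = contradiction a⟂U (covering⇒no-nonzero-orthogonal {U = U} noCover cover a a≢0)

corollary4p1 : (d n : ℕ) → (n ≡ 3 ⊎ n ≡ 2 ^ d) → h₄≡ n 0
corollary4p1 d n (inj₁ refl) = no-covering-hyperplane⇒h₄≡0 no-covering-hyperplane-3
corollary4p1 d n (inj₂ refl) = no-covering-hyperplane⇒h₄≡0 {{m^n≢0 2 d}}
                                 (nilpotent-Δ⇒no-covering-hyperplane (2 ^ d) (Δ-nilpotent d))
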